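{- If $n-k \leq m(x)$ and $range(x) \leq \ell$, then both sets $M(x)$ and $P(x)$ are intervals of $[n]$ with respect to the cyclic order on $[n]$.
   Context: Fix integers $n,k,\ell$ with $0<k<n$ and $1<\ell$, and an integer vector $x=(x_1,\ldots,x_n)$ with $x_1\le\cdots\le x_n$. Let $m(x)$ be the number of entries of $x$ that are multiples of $\ell$, and $range(x)=x_n-x_1$. The bears of $x$ are $n-k$ indices chosen as follows: if $n-k\le m(x)$, take the indices of the $n-k$ smallest entries that are multiples of $\ell$; if $n-k>m(x)$, take all $m(x)$ such indices and add $n-k-m(x)$ others (e.g. the largest ones); ties are broken by always choosing the entries with the largest indices (the rightmost ones). The remaining $k$ indices are bulls. $M=M(x)$ is the set of indices $i$ with $x_i$ a multiple of $\ell$ (so $|M|=m(x)$), and $P=P(x)$ is the set of bears (so $|P|=n-k$). The set $[n]=\{1,\ldots,n\}$ is given the cyclic order in which $1$ and $n$ are neighbors; an interval is a set of cyclically consecutive elements (single elements and the empty set count as intervals). -}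

module Defs where

open import Data.Nat as ℕ using (ℕ; zero; suc; _∸_)
open import Data.Integer as ℤ using (ℤ; +_; _-_)
open import Data.Integer.Properties as ℤP using ()
open import Data.Integer.Divisibility.Signed using (_∣_; _∣?_)
open import Data.Fin as Fin using (Fin; toℕ; fromℕ)
open import Data.Fin.Properties as FinP using ()
open import Data.List using (List; length; filter; allFin)
open import Data.Product using (_×_; ∃-syntax)
open import Data.Sum using (_⊎_)
open import Relation.Nullary using (¬_; Dec; yes; no)
open import Relation.Nullary.Decidable using (_×-dec_; _⊎-dec_; ¬?)
open import Relation.Binary.PropositionalEquality using (_≡_)
open import Function.Bundles using (_⇔_)

Sorted : {n : ℕ} → (Fin n → ℤ) → Set
Sorted {n} x = ∀ (i j : Fin n) → i Fin.≤ j → x i ℤ.≤ x j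

-- range(x) = xₙ - x₁ (0 for the empty vector, irrelevant here since n > 0)
range : {n : ℕ} → (Fin n → ℤ) → ℤ
range {zero}  x = + 0
range {suc n} x = x (fromℕ n) - x Fin.zero

M : {n : ℕ} (ℓ : ℕ) → (Fin n → ℤ) → Fin n → Set
M ℓ x i = (+ ℓ) ∣ x i

M? : {n : ℕ} (ℓ : ℕ) (x : Fin n → ℤ) (i : Fin n) → Dec (M ℓ x i)
M? ℓ x i = (+ ℓ) ∣? x i

m : {n : ℕ} (ℓ : ℕ) → (Fin n → ℤ) → ℕ
m {n} ℓ x = length (filter (M? ℓ x) (allFin n))

-- Selection order for bears among multiples: j is selected before i
-- iff x_j < x_i, or x_j = x_i and j is to the right of i (ties → largest index).
SelectedBefore : {n : ℕ} → (Fin n → ℤ) → Fin n → Fin n → Set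
SelectedBefore x j i = (x j ℤ.< x i) ⊎ ((x j ≡ x i) × (i Fin.< j))

SelectedBefore? : {n : ℕ} (x : Fin n → ℤ) (j i : Fin n) → Dec (SelectedBefore x j i)
SelectedBefore? x j i = (x j ℤ.<? x i) ⊎-dec ((x j ℤ.≟ x i) ×-dec (i Fin.<? j))

rankM : {n : ℕ} (ℓ : ℕ) → (Fin n → ℤ) → Fin n → ℕ
rankM {n} ℓ x i =
  length (filter (λ j → M? ℓ x j ×-dec SelectedBefore? x j i) (allFin n))

rankNonM : {n : ℕ} (ℓ : ℕ) → (Fin n → ℤ) → Fin n → ℕ
rankNonM {n} ℓ x i =
  length (filter (λ j → ¬? (M? ℓ x j) ×-dec (i Fin.<? j)) (allFin n))

-- P(x): the bears (n - k of them).
P : {n : ℕ} (k ℓ : ℕ) → (Fin n → ℤ) → Fin n → Set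
P {n} k ℓ x i =
  ((n ∸ k ℕ.≤ m ℓ x) × (M ℓ x i × rankM ℓ x i ℕ.< n ∸ k))
  ⊎ ((m ℓ x ℕ.< n ∸ k) × (M ℓ x i ⊎ (¬ M ℓ x i × rankNonM ℓ x i ℕ.< (n ∸ k) ∸ m ℓ x)))

-- i lies on the cyclic arc of length len starting at a: i ∈ {a, a+1, …, a+len-1} mod n
InArc : {n : ℕ} → Fin n → ℕ → Fin n → Set
InArc {n} a len i =
  ((toℕ a ℕ.≤ toℕ i) × (toℕ i ℕ.< toℕ a ℕ.+ len)) ⊎ (toℕ i ℕ.+ n ℕ.< toℕ a ℕ.+ len)

-- S ⊆ [n] is an interval for the cyclic order (1 and n neighbours);
-- len = 0 gives ∅, len = 1 singletons, len = n the whole set.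
IsCyclicInterval : {n : ℕ} → (Fin n → Set) → Set
IsCyclicInterval {n} S =
  ∃[ a ] ∃[ len ] (len ℕ.≤ n) × (∀ i → S i ⇔ InArc a len i)

-- A subset of [n] is a cyclic interval as soon as it or its complement is convex for the linear
-- order. Both M(x) and the bears are sets S of multiples of ℓ that are closed downwards under the
-- selection order. If S has a hole, i < j < k with i, k ∈ S and j ∉ S, then x_i < x_k are
-- multiples of ℓ, so x_k ≥ x_i + ℓ, and range(x) ≤ ℓ forces x_i = min x and x_k = max x.
-- A hole i′ < j′ < k′ of the complement (j′ ∈ S) then gives min x ≤ x_i′ ≤ x_j′ = min x and
-- x_i′ < x_k′ ≤ x_k, so i′ is a multiple selected before k, i.e. i′ ∈ S: S and its complement
-- cannot both have holes.
module Submission where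

open import Defs
open import Data.Nat using (ℕ; zero; suc; _+_; _<_; _∸_; _≤_; z≤n; s≤s; s≤s⁻¹; _<?_)
import Data.Nat.Properties as ℕP
open import Data.Integer using (ℤ; +_; _*_; _-_) renaming (suc to sucℤ)
open import Data.Integer as ℤ using ()
import Data.Integer.Properties as ℤP
open import Data.Integer.Divisibility.Signed using (_∣_; divides)
open import Data.Integer.Tactic.RingSolver using (solve-∀)
open import Data.Fin as Fin using (Fin; toℕ; fromℕ; fromℕ<)
import Data.Fin.Properties as FinP
import Data.Fin.Induction as FinInd
open import Data.List using (allFin)
open import Data.List.Relation.Binary.Sublist.Propositional.Properties
  using (filter⁺; length-mono-≤)
open import Data.List.Relation.Binary.Sublist.Propositional using (⊆-refl)
open import Data.Product using (_×_; _,_; proj₁; proj₂; ∃-syntax)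
open import Data.Sum using (_⊎_; inj₁; inj₂)
open import Data.Empty using (⊥-elim)
open import Function using (id)
open import Function.Bundles using (_⇔_; mk⇔; Equivalence)
open import Function.Construct.Composition using (_⇔-∘_)
open import Function.Construct.Symmetry using (⇔-sym)
open import Induction.WellFounded using (WellFounded; Acc; acc)
open import Level using (0ℓ)
open import Relation.Binary.Core using (Rel)
open import Relation.Binary.Definitions using () renaming (Decidable to Decidable₂)
open import Relation.Binary.PropositionalEquality
  using (_≡_; refl; sym; trans; subst; cong; module ≡-Reasoning)
open import Relation.Nullary using (¬_; Dec; yes; no)
open import Relation.Nullary.Decidable using (_×-dec_; decidable-stable)
open import Relation.Unary using (Decidable; ∁)
open import Relation.Unary.Properties using (∁?)

private
  variable
    n : ℕ

Convex : (Fin n → Set) → Set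
Convex S = ∀ {i j k} → i Fin.< j → j Fin.< k → S i → S k → S j

Gap : (Fin n → Set) → Set
Gap S = ∃[ i ] ∃[ j ] ∃[ k ] i Fin.< j × j Fin.< k × S i × ¬ S j × S k

cyclicInterval-resp-⇔ : {S T : Fin n → Set} →
  (∀ i → S i ⇔ T i) → IsCyclicInterval S → IsCyclicInterval T
cyclicInterval-resp-⇔ S⇔T (a , len , len≤n , S⇔arc) =
  a , len , len≤n , λ i → S⇔arc i ⇔-∘ ⇔-sym (S⇔T i)

module _ {S : Fin n → Set} (S? : Decidable S) where

  minimal : {R : Rel (Fin n) 0ℓ} → Decidable₂ R → WellFounded R →
    ∀ {i} → S i → ∃[ a ] S a × (∀ {j} → R j a → ¬ S j)
  minimal {R} R? wf {i} si = search (wf i) si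
    where
    search : ∀ {i} → Acc R i → S i → ∃[ a ] S a × (∀ {j} → R j a → ¬ S j)
    search {i} (acc below) si with FinP.any? (λ j → R? j i ×-dec S? j)
    ... | yes (j , Rji , sj) = search (below Rji) sj
    ... | no none = i , si , λ Rji sj → none (_ , Rji , sj)

  least : ∀ {i} → S i → ∃[ a ] S a × (∀ {j} → j Fin.< a → ¬ S j)
  least = minimal Fin._<?_ FinInd.<-wellFounded

  greatest : ∀ {i} → S i → ∃[ b ] S b × (∀ {j} → b Fin.< j → ¬ S j)
  greatest = minimal (λ i j → j Fin.<? i) FinInd.>-wellFounded

  gap? : Dec (Gap S)
  gap? = FinP.any? λ i → FinP.any? λ j → FinP.any? λ k →
    (i Fin.<? j) ×-dec (j Fin.<? k) ×-dec S? i ×-dec ∁? S? j ×-dec S? k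

convex-between : {S : Fin n → Set} → Convex S →
  ∀ {a i b} → S a → S b → a Fin.≤ i → i Fin.≤ b → S i
convex-between {S = S} convex sa sb a≤i i≤b
  with ℕP.m≤n⇒m<n∨m≡n a≤i | ℕP.m≤n⇒m<n∨m≡n i≤b
... | inj₂ a≡i | _        = subst S (FinP.toℕ-injective a≡i) sa
... | inj₁ _   | inj₂ i≡b = subst S (FinP.toℕ-injective (sym i≡b)) sb
... | inj₁ a<i | inj₁ i<b = convex a<i i<b sa sb

inArc-unwrapped : {a i : Fin n} {len : ℕ} → toℕ a + len ≤ n →
  InArc a len i ⇔ (a Fin.≤ i × toℕ i < toℕ a + len)
inArc-unwrapped {n} {a} {i} {len} a+len≤n = mk⇔ unwrap inj₁
  where
  unwrap : InArc a len i → a Fin.≤ i × toℕ i < toℕ a + len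
  unwrap (inj₁ inside)   = inside
  unwrap (inj₂ i+n<a+len) =
    ⊥-elim (ℕP.<⇒≱ (ℕP.<-≤-trans i+n<a+len a+len≤n) (ℕP.m≤n+m n (toℕ i)))

inArc-wrapped : {a i : Fin n} {len c : ℕ} → toℕ a + len ≡ c + n →
  InArc a len i ⇔ (toℕ i < c ⊎ a Fin.≤ i)
inArc-wrapped {n} {a} {i} {len} {c} a+len≡c+n = mk⇔ to from
  where
  to : InArc a len i → toℕ i < c ⊎ a Fin.≤ i
  to (inj₁ (a≤i , _)) = inj₂ a≤i
  to (inj₂ i+n<a+len) =
    inj₁ (ℕP.+-cancelʳ-< n (toℕ i) c (subst (toℕ i + n <_) a+len≡c+n i+n<a+len))
  from : toℕ i < c ⊎ a Fin.≤ i → InArc a len i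
  from (inj₁ i<c) = inj₂ (subst (toℕ i + n <_) (sym a+len≡c+n) (ℕP.+-monoˡ-< n i<c))
  from (inj₂ a≤i) = inj₁ (a≤i , subst (toℕ i <_) (sym a+len≡c+n)
                                  (ℕP.<-≤-trans (FinP.toℕ<n i) (ℕP.m≤n+m n c)))

module _ {S : Fin (suc n) → Set} (S? : Decidable S) where

  convex⇒cyclicInterval : Convex S → IsCyclicInterval S
  convex⇒cyclicInterval convex with FinP.any? S?
  ... | no ∄S = Fin.zero , 0 , z≤n , λ i →
    mk⇔ (λ si → ⊥-elim (∄S (i , si))) λ { (inj₁ (_ , ())) ; (inj₂ ()) }
  ... | yes (_ , si) with least S? si | greatest S? si
  ... | a , sa , below-a | b , sb , above-b =
    a , len , len≤n , λ i → ⇔-sym (inArc-unwrapped a+len≤n) ⇔-∘ mk⇔ (to i) (from i)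
    where
    len : ℕ
    len = suc (toℕ b) ∸ toℕ a
    a≤b : a Fin.≤ b
    a≤b = ℕP.≮⇒≥ λ b<a → below-a b<a sb
    a+len≡b+1 : toℕ a + len ≡ suc (toℕ b)
    a+len≡b+1 = ℕP.m+[n∸m]≡n (ℕP.m≤n⇒m≤1+n a≤b)
    a+len≤n : toℕ a + len ≤ suc n
    a+len≤n = subst (_≤ suc n) (sym a+len≡b+1) (FinP.toℕ<n b)
    len≤n : len ≤ suc n
    len≤n = ℕP.≤-trans (ℕP.m≤n+m len (toℕ a)) a+len≤n
    to : ∀ i → S i → a Fin.≤ i × toℕ i < toℕ a + len
    to i si = ℕP.≮⇒≥ (λ i<a → below-a i<a si) ,
              subst (toℕ i <_) (sym a+len≡b+1) (s≤s (ℕP.≮⇒≥ λ b<i → above-b b<i si))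
    from : ∀ i → a Fin.≤ i × toℕ i < toℕ a + len → S i
    from i (a≤i , i<a+len) =
      convex-between convex sa sb a≤i (s≤s⁻¹ (subst (toℕ i <_) a+len≡b+1 i<a+len))

  outside⇒cyclicInterval : (c d : Fin (suc n)) → c Fin.≤ d →
    (∀ i → S i ⇔ (i Fin.< c ⊎ d Fin.< i)) → IsCyclicInterval S
  outside⇒cyclicInterval c d c≤d S⇔outside with suc (toℕ d) <? suc n
  ... | yes d+1<n =
    a , len , len≤n , λ i → ⇔-sym (inArc-wrapped a+len≡c+n) ⇔-∘ mk⇔ (to i) (from i)
    where
    a : Fin (suc n)
    a = fromℕ< d+1<n
    len : ℕ
    len = (suc n ∸ suc (toℕ d)) + toℕ c
    a≡d+1 : toℕ a ≡ suc (toℕ d)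
    a≡d+1 = FinP.toℕ-fromℕ< d+1<n
    a+len≡c+n : toℕ a + len ≡ toℕ c + suc n
    a+len≡c+n = begin
      toℕ a + len
        ≡⟨ cong (_+ len) a≡d+1 ⟩
      suc (toℕ d) + (suc n ∸ suc (toℕ d) + toℕ c)
        ≡⟨ ℕP.+-assoc (suc (toℕ d)) _ (toℕ c) ⟨
      suc (toℕ d) + (suc n ∸ suc (toℕ d)) + toℕ c
        ≡⟨ cong (_+ toℕ c) (ℕP.m+[n∸m]≡n (ℕP.<⇒≤ d+1<n)) ⟩
      suc n + toℕ c
        ≡⟨ ℕP.+-comm (suc n) (toℕ c) ⟩
      toℕ c + suc n
        ∎
      where open ≡-Reasoning
    len≤n : len ≤ suc n
    len≤n = ℕP.≤-trans (ℕP.+-monoʳ-≤ (suc n ∸ suc (toℕ d)) (ℕP.m≤n⇒m≤1+n c≤d))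
                       (ℕP.≤-reflexive (ℕP.m∸n+n≡m (ℕP.<⇒≤ d+1<n)))
    to : ∀ i → S i → toℕ i < toℕ c ⊎ a Fin.≤ i
    to i si with Equivalence.to (S⇔outside i) si
    ... | inj₁ i<c = inj₁ i<c
    ... | inj₂ d<i = inj₂ (subst (_≤ toℕ i) (sym a≡d+1) d<i)
    from : ∀ i → toℕ i < toℕ c ⊎ a Fin.≤ i → S i
    from i (inj₁ i<c) = Equivalence.from (S⇔outside i) (inj₁ i<c)
    from i (inj₂ a≤i) =
      Equivalence.from (S⇔outside i) (inj₂ (subst (_≤ toℕ i) a≡d+1 a≤i))
  ... | no d+1≮n = Fin.zero , toℕ c , ℕP.<⇒≤ (FinP.toℕ<n c) , λ i →
    ⇔-sym (inArc-unwrapped (ℕP.<⇒≤ (FinP.toℕ<n c))) ⇔-∘ mk⇔ (to i) (from i)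
    where
    to : ∀ i → S i → Fin.zero {n} Fin.≤ i × i Fin.< c
    to i si with Equivalence.to (S⇔outside i) si
    ... | inj₁ i<c = z≤n , i<c
    ... | inj₂ d<i = ⊥-elim (d+1≮n (ℕP.<-≤-trans (s≤s d<i) (FinP.toℕ<n i)))
    from : ∀ i → Fin.zero {n} Fin.≤ i × i Fin.< c → S i
    from i (_ , i<c) = Equivalence.from (S⇔outside i) (inj₁ i<c)

  coconvex⇒cyclicInterval : Convex (∁ S) → IsCyclicInterval S
  coconvex⇒cyclicInterval convex with FinP.any? (∁? S?)
  ... | no ∄¬S = Fin.zero , suc n , ℕP.≤-refl , λ i →
    mk⇔ (λ _ → inj₁ (z≤n , FinP.toℕ<n i))
        (λ _ → decidable-stable (S? i) λ ¬si → ∄¬S (i , ¬si))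
  ... | yes (_ , ¬si) with least (∁? S?) ¬si | greatest (∁? S?) ¬si
  ... | c , ¬sc , below-c | d , ¬sd , above-d =
    outside⇒cyclicInterval c d c≤d λ i → mk⇔ (to i) (from i)
    where
    c≤d : c Fin.≤ d
    c≤d = ℕP.≮⇒≥ λ d<c → below-c d<c ¬sd
    to : ∀ i → S i → i Fin.< c ⊎ d Fin.< i
    to i si with i Fin.<? c | d Fin.<? i
    ... | yes i<c | _       = inj₁ i<c
    ... | no _    | yes d<i = inj₂ d<i
    ... | no i≮c  | no d≮i  =
      ⊥-elim (convex-between convex ¬sc ¬sd (ℕP.≮⇒≥ i≮c) (ℕP.≮⇒≥ d≮i) si)
    from : ∀ i → i Fin.< c ⊎ d Fin.< i → S i
    from i (inj₁ i<c) = decidable-stable (S? i) (below-c i<c)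
    from i (inj₂ d<i) = decidable-stable (S? i) (above-d d<i)

  gapless-or-cogapless⇒cyclicInterval : (Gap S → Convex (∁ S)) → IsCyclicInterval S
  gapless-or-cogapless⇒cyclicInterval gap⇒coconvex with gap? S?
  ... | yes gap = coconvex⇒cyclicInterval (gap⇒coconvex gap)
  ... | no ∄gap = convex⇒cyclicInterval λ i<j j<k si sk →
    decidable-stable (S? _) λ ¬sj → ∄gap (_ , _ , _ , i<j , j<k , si , ¬sj , sk)

multiples-<⇒+≤ : ∀ {ℓ a b} → + ℓ ∣ a → + ℓ ∣ b → a ℤ.< b → a ℤ.+ + ℓ ℤ.≤ b
multiples-<⇒+≤ {ℓ} (divides p refl) (divides q refl) pℓ<qℓ = begin
  p * + ℓ ℤ.+ + ℓ  ≡⟨ [1+p]d≡pd+d p (+ ℓ) ⟨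
  sucℤ p * + ℓ     ≤⟨ ℤP.*-monoʳ-≤-nonNeg (+ ℓ) (ℤP.i<j⇒suc[i]≤j p<q) ⟩
  q * + ℓ          ∎
  where
  open ℤP.≤-Reasoning
  p<q : p ℤ.< q
  p<q = ℤP.*-cancelʳ-<-nonNeg (+ ℓ) pℓ<qℓ
  [1+p]d≡pd+d : ∀ p d → (+ 1 ℤ.+ p) * d ≡ p * d ℤ.+ d
  [1+p]d≡pd+d = solve-∀

sorted⇒spread : {x : Fin (suc n) → ℤ} {r : ℤ} → Sorted x → range x ℤ.≤ r →
  ∀ i j → x i ℤ.≤ x j ℤ.+ r
sorted⇒spread {n} {x} {r} sorted range≤r i j = begin
  x i                                        ≤⟨ sorted i (fromℕ n) (FinP.≤fromℕ i) ⟩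
  x (fromℕ n)                                ≡⟨ a+[b-a]≡b (x Fin.zero) (x (fromℕ n)) ⟨
  x Fin.zero ℤ.+ (x (fromℕ n) - x Fin.zero)  ≤⟨ ℤP.+-monoʳ-≤ (x Fin.zero) range≤r ⟩
  x Fin.zero ℤ.+ r                           ≤⟨ ℤP.+-monoˡ-≤ r (sorted Fin.zero j z≤n) ⟩
  x j ℤ.+ r                                  ∎
  where
  open ℤP.≤-Reasoning
  a+[b-a]≡b : ∀ a b → a ℤ.+ (b - a) ≡ b
  a+[b-a]≡b = solve-∀

module _ {n : ℕ} (ℓ : ℕ) (x : Fin n → ℤ) where

  SelectedBefore-trans : ∀ {s t u} →
    SelectedBefore x s t → SelectedBefore x t u → SelectedBefore x s u
  SelectedBefore-trans (inj₁ s<t)         (inj₁ t<u)         = inj₁ (ℤP.<-trans s<t t<u)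
  SelectedBefore-trans (inj₁ s<t)         (inj₂ (t≡u , _))   = inj₁ (subst (x _ ℤ.<_) t≡u s<t)
  SelectedBefore-trans (inj₂ (s≡t , _))   (inj₁ t<u)         =
    inj₁ (subst (ℤ._< x _) (sym s≡t) t<u)
  SelectedBefore-trans (inj₂ (s≡t , t<s)) (inj₂ (t≡u , u<t)) =
    inj₂ (trans s≡t t≡u , ℕP.<-trans u<t t<s)

  rankM-mono : ∀ {s t} → SelectedBefore x s t → rankM ℓ x s ≤ rankM ℓ x t
  rankM-mono s≺t = length-mono-≤ (filter⁺
    (λ j → M? ℓ x j ×-dec SelectedBefore? x j _)
    (λ j → M? ℓ x j ×-dec SelectedBefore? x j _)
    (λ { refl (mj , j≺s) → mj , SelectedBefore-trans j≺s s≺t })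
    (⊆-refl {x = allFin n}))

  SelectionClosed : (Fin n → Set) → Set
  SelectionClosed S = ∀ {s t} → M ℓ x s → SelectedBefore x s t → S t → S s

  FirstSelected : ℕ → Fin n → Set
  FirstSelected r i = M ℓ x i × rankM ℓ x i < r

  FirstSelected? : ∀ r → Decidable (FirstSelected r)
  FirstSelected? r i = M? ℓ x i ×-dec (rankM ℓ x i <? r)

  FirstSelected-closed : ∀ r → SelectionClosed (FirstSelected r)
  FirstSelected-closed r ms s≺t (_ , rank-t<r) = ms , ℕP.≤-<-trans (rankM-mono s≺t) rank-t<r

  module _ (spread : ∀ i j → x i ℤ.≤ x j ℤ.+ + ℓ) where

    multiples-bracket : ∀ {a b} → M ℓ x a → M ℓ x b → x a ℤ.< x b →
      ∀ y → x a ℤ.≤ x y × x y ℤ.≤ x b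
    multiples-bracket {a} {b} ma mb xa<xb y =
      ℤP.≮⇒≥ (λ xy<xa → ℤP.<⇒≱ (ℤP.+-monoˡ-< (+ ℓ) xy<xa) (ℤP.≤-trans xa+ℓ≤xb (spread b y)))
      ,
      ℤP.≤-trans (spread y a) xa+ℓ≤xb
      where
      xa+ℓ≤xb : x a ℤ.+ + ℓ ℤ.≤ x b
      xa+ℓ≤xb = multiples-<⇒+≤ ma mb xa<xb

    module _ (sorted : Sorted x) {S : Fin n → Set}
             (S⊆M : ∀ {i} → S i → M ℓ x i) (closed : SelectionClosed S) where

      leaving⇒ascending : ∀ {s t} → S t → ¬ S s → t Fin.< s → x t ℤ.< x s
      leaving⇒ascending st ¬ss t<s = ℤP.≤∧≢⇒< (sorted _ _ (ℕP.<⇒≤ t<s)) λ xt≡xs →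
        ¬ss (closed (subst (+ ℓ ∣_) xt≡xs (S⊆M st)) (inj₂ (sym xt≡xs , t<s)) st)

      gap⇒coconvex : Gap S → Convex (∁ S)
      gap⇒coconvex (i , j , k , i<j , j<k , si , ¬sj , sk) {i′} {j′} {k′}
                   i′<j′ j′<k′ ¬si′ ¬sk′ sj′ =
        ¬si′ (closed mi′ (inj₁ (ℤP.≤-<-trans xi′≤xj′ xj′<xk)) sk)
        where
        xi<xk : x i ℤ.< x k
        xi<xk = ℤP.<-≤-trans (leaving⇒ascending si ¬sj i<j) (sorted j k (ℕP.<⇒≤ j<k))
        xj′<xk : x j′ ℤ.< x k
        xj′<xk = ℤP.<-≤-trans (leaving⇒ascending sj′ ¬sk′ j′<k′)
                              (proj₂ (multiples-bracket (S⊆M si) (S⊆M sk) xi<xk k′))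
        xi′≤xj′ : x i′ ℤ.≤ x j′
        xi′≤xj′ = sorted i′ j′ (ℕP.<⇒≤ i′<j′)
        xi′≡xi : x i′ ≡ x i
        xi′≡xi = ℤP.≤-antisym
          (ℤP.≤-trans xi′≤xj′ (proj₁ (multiples-bracket (S⊆M sj′) (S⊆M sk) xj′<xk i)))
          (proj₁ (multiples-bracket (S⊆M si) (S⊆M sk) xi<xk i′))
        mi′ : M ℓ x i′
        mi′ = subst (+ ℓ ∣_) (sym xi′≡xi) (S⊆M si)

selectionClosed⇒cyclicInterval : ∀ {n ℓ} {x : Fin (suc n) → ℤ} {S : Fin (suc n) → Set} →
  Sorted x → range x ℤ.≤ + ℓ → Decidable S →
  (∀ {i} → S i → M ℓ x i) → SelectionClosed ℓ x S → IsCyclicInterval S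
selectionClosed⇒cyclicInterval {ℓ = ℓ} {x} sorted range≤ℓ S? S⊆M closed =
  gapless-or-cogapless⇒cyclicInterval S?
    (gap⇒coconvex ℓ x (sorted⇒spread sorted range≤ℓ) sorted S⊆M closed)

FirstSelected⇔P : ∀ {n} k {ℓ} {x : Fin n → ℤ} → n ∸ k ≤ m ℓ x →
  ∀ i → FirstSelected ℓ x (n ∸ k) i ⇔ P k ℓ x i
FirstSelected⇔P k n∸k≤m i = mk⇔
  (λ first → inj₁ (n∸k≤m , first))
  (λ { (inj₁ (_ , first)) → first ; (inj₂ (m<n∸k , _)) → ⊥-elim (ℕP.<⇒≱ m<n∸k n∸k≤m) })

proposition2 : (n k ℓ : ℕ) → 0 < k → k < n → 1 < ℓ →
    (x : Fin n → ℤ) → Sorted x →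
    n ∸ k ≤ m ℓ x → range x ℤ.≤ + ℓ →
    IsCyclicInterval (M ℓ x) × IsCyclicInterval (P k ℓ x)
proposition2 zero    k ℓ _ () _ x sorted n∸k≤m range≤ℓ
proposition2 (suc n) k ℓ _ _  _ x sorted n∸k≤m range≤ℓ =
  selectionClosed⇒cyclicInterval sorted range≤ℓ (M? ℓ x) id (λ ms _ _ → ms) ,
  cyclicInterval-resp-⇔ (FirstSelected⇔P k n∸k≤m)
    (selectionClosed⇒cyclicInterval sorted range≤ℓ
      (FirstSelected? ℓ x _) proj₁ (FirstSelected-closed ℓ x _))
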